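{- Let $G$ be a strongly connected directed graph that is not a closed path, and let $v$ be a bivalent node of $G$. Let $f_1\neq f_2$ be join arcs with $h(f_1)=h(f_2)=v$, and $g_1\neq g_2$ be split arcs with $t(g_1)=t(g_2)=v$. Then: (i) if $f_1g_1$ and $f_2g_2$ are both omnitigs, then $d^+(v)=d^-(v)=2$; (ii) if $f_1g_1$ is an omnitig, then there is no omnitig $f_1g'$ with $g'\neq g_1$, and no omnitig $f'g_1$ with $f'\neq f_1$.
   Context: Graphs are finite directed multigraphs (parallel arcs and self-loops allowed); $t(e)$, $h(e)$ are tail and head of arc $e$; $d^-(v)$, $d^+(v)$ are in- and out-degree. A walk is a sequence of arcs $e_1\dots e_\ell$ with $h(e_i)=t(e_{i+1})$; a path is a walk with distinct nodes except the last may equal the first. A closed path is a graph consisting of a single cycle. A node $v$ is a join node if $d^-(v)>1$, a split node if $d^+(v)>1$, bivalent if both. An arc $f$ is a join arc if $h(f)$ is a join node, a split arc if $t(f)$ is a split node. A walk $W=e_0\dots e_\ell$ is an omnitig if for all $1\le i\le j\le \ell$ there is no non-empty path from $t(e_j)$ to $h(e_{i-1})$ whose first arc differs from $e_j$ and whose last arc differs from $e_{i-1}$. -}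

module Defs where

open import Data.Nat using (ℕ; _<_; _>_)
open import Data.Fin using (Fin; toℕ; _≟_)
open import Data.List using (List; []; _∷_; map; length; filter; lookup)
open import Data.List.NonEmpty as L⁺ using (List⁺; _∷_; toList; last)
open import Data.List.Relation.Unary.Linked using (Linked)
open import Data.List.Relation.Unary.Unique.Propositional using (Unique)
open import Data.List.Relation.Unary.All using (All)
open import Data.List.Membership.Propositional using (_∈_)
open import Data.List.Base using (allFin)
open import Data.Product using (Σ; _×_; ∃)
open import Relation.Nullary using (¬_)
open import Relation.Binary.PropositionalEquality using (_≡_; _≢_)

record Graph : Set where
  field
    nodes : ℕ
    arcs  : ℕ
    tl    : Fin arcs → Fin nodes
    hd    : Fin arcs → Fin nodes

module _ (G : Graph) where
  open Graph G

  Node : Set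
  Node = Fin nodes

  Arc : Set
  Arc = Fin arcs

  indeg : Node → ℕ
  indeg v = length (filter (λ e → hd e ≟ v) (allFin arcs))

  outdeg : Node → ℕ
  outdeg v = length (filter (λ e → tl e ≟ v) (allFin arcs))

  JoinNode : Node → Set
  JoinNode v = 1 < indeg v

  SplitNode : Node → Set
  SplitNode v = 1 < outdeg v

  Bivalent : Node → Set
  Bivalent v = JoinNode v × SplitNode v

  JoinArc : Arc → Set
  JoinArc f = JoinNode (hd f)

  SplitArc : Arc → Set
  SplitArc f = SplitNode (tl f)

  IsWalk : List Arc → Set
  IsWalk = Linked (λ e e′ → hd e ≡ tl e′)

  WalkFromTo : Node → Node → List Arc → Set
  WalkFromTo u w []       = u ≡ w
  WalkFromTo u w (e ∷ es) = IsWalk (e ∷ es) × tl e ≡ u × hd (last (e ∷ es)) ≡ w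

  -- a path: a walk whose nodes t(e₁), h(e₁), …, h(e_ℓ) are distinct,
  -- except that the last may equal the first.  Since t(e_{i+1}) = h(e_i),
  -- this says: the node lists t(e₁)…t(e_ℓ) and h(e₁)…h(e_ℓ) are each duplicate-free.
  IsPath : List Arc → Set
  IsPath p = IsWalk p × Unique (map tl p) × Unique (map hd p)

  NEPathFromTo : Node → Node → List⁺ Arc → Set
  NEPathFromTo u w p = IsPath (toList p) × tl (L⁺.head p) ≡ u × hd (last p) ≡ w

  StronglyConnected : Set
  StronglyConnected = ∀ (u w : Node) → ∃ λ (p : List Arc) → WalkFromTo u w p

  IsClosedPath : Set
  IsClosedPath = ∃ λ (p : List⁺ Arc) →
      IsPath (toList p)
    × hd (last p) ≡ tl (L⁺.head p)
    × (∀ (e : Arc) → e ∈ toList p)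
    × (∀ (x : Node) → x ∈ map tl (toList p))

  -- W = e₀ … e_ℓ is an omnitig: a non-empty walk such that for all
  -- 1 ≤ i ≤ j ≤ ℓ there is no non-empty path from t(e_j) to h(e_{i-1}) whose
  -- first arc differs from e_j and whose last arc differs from e_{i-1}.
  -- (Below k stands for i-1, so the condition 1 ≤ i ≤ j becomes k < j.)
  IsOmnitig : List Arc → Set
  IsOmnitig W =
      W ≢ []
    × IsWalk W
    × (∀ (k j : Fin (length W)) → toℕ k < toℕ j →
         ¬ (∃ λ (p : List⁺ Arc) →
              NEPathFromTo (tl (lookup W j)) (hd (lookup W k)) p
            × L⁺.head p ≢ lookup W j
            × last p ≢ lookup W k))

-- Strong connectivity closes every arc at v into a closed path through v (a walk back
-- is shortened to a simple path).  If f g is an omnitig, a closed path at v that leaves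
-- by an arc other than g must come back by f: otherwise it is a path from t(g) to h(f)
-- avoiding g first and f last, which the omnitig forbids.  With omnitigs f₁g₁ and f₂g₂
-- (f₁ ≠ f₂), a third out-arc would start a closed path coming back by both f₁ and f₂,
-- and the closed path coming back by any in-arc leaves by an arc other than g₁ or other
-- than g₂, so that in-arc is f₁ or f₂.  Part (ii) is the same argument with the two
-- omnitigs sharing an arc.
module Submission where

open import Defs
open import Data.Empty using (⊥; ⊥-elim)
open import Data.Fin as Fin using (zero; suc)
open import Data.List as List using (List; []; _∷_; _∷ʳ_; map; length; allFin)
open import Data.List.Properties using (map-++)
open import Data.List.NonEmpty as L⁺ using (_∷_; toList; last)
open import Data.List.Membership.Propositional using (_∈_; _∉_)
open import Data.List.Relation.Unary.All as All using (All; []; _∷_)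
open import Data.List.Relation.Unary.All.Properties using (¬Any⇒All¬; all-filter)
open import Data.List.Relation.Unary.AllPairs using ([]; _∷_)
open import Data.List.Relation.Unary.Any using (here; there)
open import Data.List.Relation.Unary.Linked using ([-]; _∷_)
open import Data.List.Relation.Unary.Unique.Propositional using (Unique)
import Data.List.Relation.Unary.Unique.Propositional.Properties as Unique
open import Data.Nat using (_≤_; z≤n; s≤s)
open import Data.Nat.Properties using (≤-antisym)
open import Data.Product using (∃; _×_; _,_; proj₁; proj₂)
open import Data.Sum using (_⊎_; inj₁; inj₂; reduce)
open import Relation.Nullary using (¬_; yes; no)
open import Relation.Binary.PropositionalEquality
  using (_≡_; _≢_; refl; sym; trans; cong; subst; ≢-sym; setoid)

last-∷-∷ : ∀ {A : Set} (x y : A) ys → last (x ∷ y ∷ ys) ≡ last (y ∷ ys)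
last-∷-∷ x y ys with List.initLast ys
... | []            = refl
... | zs List.∷ʳ′ z = refl

last-∷ʳ : ∀ {A : Set} (xs : List A) y → last (xs L⁺.∷ʳ y) ≡ y
last-∷ʳ []           y = refl
last-∷ʳ (x ∷ [])      y = refl
last-∷ʳ (x ∷ x′ ∷ xs) y = trans (last-∷-∷ x x′ (xs ∷ʳ y)) (last-∷ʳ (x′ ∷ xs) y)

toList-∷ʳ : ∀ {A : Set} (xs : List A) y → toList (xs L⁺.∷ʳ y) ≡ xs ∷ʳ y
toList-∷ʳ []       y = refl
toList-∷ʳ (x ∷ xs) y = refl

module _ {A : Set} where
  open import Data.List.Relation.Binary.Permutation.Setoid.Properties (setoid A)
    using (Unique-resp-↭; ∷↭∷ʳ)
  open import Data.List.Relation.Binary.Permutation.Setoid (setoid A) using (↭-sym)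

  Unique-∷⇒∷ʳ : ∀ {x : A} {xs} → Unique (x ∷ xs) → Unique (xs ∷ʳ x)
  Unique-∷⇒∷ʳ {x} {xs} = Unique-resp-↭ (∷↭∷ʳ x xs)

  Unique-∷ʳ⇒∷ : ∀ {x : A} {xs} → Unique (xs ∷ʳ x) → Unique (x ∷ xs)
  Unique-∷ʳ⇒∷ {x} {xs} = Unique-resp-↭ (↭-sym (∷↭∷ʳ x xs))

  pigeonhole₃₂ : ∀ {a b x y z : A} → x ≢ y → x ≢ z → y ≢ z →
                 x ≡ a ⊎ x ≡ b → y ≡ a ⊎ y ≡ b → z ≡ a ⊎ z ≡ b → ⊥
  pigeonhole₃₂ x≢y _   _   (inj₁ refl) (inj₁ refl) _           = x≢y refl
  pigeonhole₃₂ x≢y _   _   (inj₂ refl) (inj₂ refl) _           = x≢y refl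
  pigeonhole₃₂ _   x≢z _   (inj₁ refl) (inj₂ refl) (inj₁ refl) = x≢z refl
  pigeonhole₃₂ _   _   y≢z (inj₁ refl) (inj₂ refl) (inj₂ refl) = y≢z refl
  pigeonhole₃₂ _   _   y≢z (inj₂ refl) (inj₁ refl) (inj₁ refl) = y≢z refl
  pigeonhole₃₂ _   x≢z _   (inj₂ refl) (inj₁ refl) (inj₂ refl) = x≢z refl

  length≤2 : ∀ {a b : A} {xs} → Unique xs → All (λ x → x ≡ a ⊎ x ≡ b) xs → length xs ≤ 2
  length≤2 []                                _ = z≤n
  length≤2 (_ ∷ [])                          _ = s≤s z≤n
  length≤2 (_ ∷ _ ∷ [])                      _ = s≤s (s≤s z≤n)
  length≤2 ((x≢y ∷ x≢z ∷ _) ∷ (y≢z ∷ _) ∷ _) (x∈ab ∷ y∈ab ∷ z∈ab ∷ _) =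
    ⊥-elim (pigeonhole₃₂ x≢y x≢z y≢z x∈ab y∈ab z∈ab)

module _ (G : Graph) where
  open Graph G
  open import Data.List.Membership.DecPropositional (Fin._≟_ {nodes}) using (_∈?_)

  indeg≤2 : ∀ {v a b} → (∀ e → hd e ≡ v → e ≡ a ⊎ e ≡ b) → indeg G v ≤ 2
  indeg≤2 {v} only-a-b = length≤2 (Unique.filter⁺ _ (Unique.allFin⁺ arcs))
    (All.map (only-a-b _) (all-filter (λ e → hd e Fin.≟ v) (allFin arcs)))

  outdeg≤2 : ∀ {v a b} → (∀ e → tl e ≡ v → e ≡ a ⊎ e ≡ b) → outdeg G v ≤ 2
  outdeg≤2 {v} only-a-b = length≤2 (Unique.filter⁺ _ (Unique.allFin⁺ arcs))
    (All.map (only-a-b _) (all-filter (λ e → tl e Fin.≟ v) (allFin arcs)))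

  mutual
    data SimplePath : Node G → Node G → Set where
      []   : ∀ {w} → SimplePath w w
      cons : ∀ {u w} e → tl e ≡ u → (q : SimplePath (hd e) w) → u ∉ visited q → SimplePath u w

    visited : ∀ {u w} → SimplePath u w → List (Node G)
    visited {w = w} []             = w ∷ []
    visited {u = u} (cons _ _ q _) = u ∷ visited q

  arcList : ∀ {u w} → SimplePath u w → List (Arc G)
  arcList []             = []
  arcList (cons e _ q _) = e ∷ arcList q

  visited-unique : ∀ {u w} (q : SimplePath u w) → Unique (visited q)
  visited-unique []               = [] ∷ []
  visited-unique (cons _ _ q u∉q) = ¬Any⇒All¬ _ u∉q ∷ visited-unique q

  visited≡∷heads : ∀ {u w} (q : SimplePath u w) → visited q ≡ u ∷ map hd (arcList q)
  visited≡∷heads []             = refl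
  visited≡∷heads (cons _ _ q _) = cong (_ ∷_) (visited≡∷heads q)

  visited≡tails∷ʳ : ∀ {u w} (q : SimplePath u w) → visited q ≡ map tl (arcList q) ∷ʳ w
  visited≡tails∷ʳ []                = refl
  visited≡tails∷ʳ (cons _ refl q _) = cong (_ ∷_) (visited≡tails∷ʳ q)

  walk-∷ : ∀ {u w g} → hd g ≡ u → (q : SimplePath u w) → IsWalk G (g ∷ arcList q)
  walk-∷ _   []                = [-]
  walk-∷ g↦u (cons e refl q _) = g↦u ∷ walk-∷ refl q

  walk-∷-∷ʳ : ∀ {u w g f} → hd g ≡ u → tl f ≡ w → (q : SimplePath u w) →
              IsWalk G (g ∷ arcList q ∷ʳ f)
  walk-∷-∷ʳ g↦u f↤w []                = trans g↦u (sym f↤w) ∷ [-]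
  walk-∷-∷ʳ g↦u f↤w (cons e refl q _) = g↦u ∷ walk-∷-∷ʳ refl f↤w q

  walk-∷ʳ : ∀ {u w f} → tl f ≡ w → (q : SimplePath u w) → IsWalk G (arcList q ∷ʳ f)
  walk-∷ʳ _   []                = [-]
  walk-∷ʳ f↤w (cons e refl q _) = walk-∷-∷ʳ refl f↤w q

  hd-last-∷ : ∀ {u w g} → hd g ≡ u → (q : SimplePath u w) → hd (last (g ∷ arcList q)) ≡ w
  hd-last-∷ g↦u []                = g↦u
  hd-last-∷ g↦u (cons e refl q _) =
    trans (cong hd (last-∷-∷ _ e (arcList q))) (hd-last-∷ refl q)

  tl-head-∷ʳ : ∀ {u w f} → tl f ≡ w → (q : SimplePath u w) → tl (L⁺.head (arcList q L⁺.∷ʳ f)) ≡ u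
  tl-head-∷ʳ f↤w []             = f↤w
  tl-head-∷ʳ _   (cons _ e↤u _ _) = e↤u

  start∷heads-unique : ∀ {u w} (q : SimplePath u w) → Unique (u ∷ map hd (arcList q))
  start∷heads-unique q = subst Unique (visited≡∷heads q) (visited-unique q)

  tails∷ʳend-unique : ∀ {u w} (q : SimplePath u w) → Unique (map tl (arcList q) ∷ʳ w)
  tails∷ʳend-unique q = subst Unique (visited≡tails∷ʳ q) (visited-unique q)

  ∷-closedPath : ∀ e (q : SimplePath (hd e) (tl e)) → NEPathFromTo G (tl e) (tl e) (e ∷ arcList q)
  ∷-closedPath e q =
    (walk-∷ refl q , Unique-∷ʳ⇒∷ (tails∷ʳend-unique q) , start∷heads-unique q) ,
    refl , hd-last-∷ refl q

  ∷ʳ-closedPath : ∀ e (q : SimplePath (hd e) (tl e)) →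
                  NEPathFromTo G (hd e) (hd e) (arcList q L⁺.∷ʳ e)
  ∷ʳ-closedPath e q =
    subst (IsPath G) (sym (toList-∷ʳ (arcList q) e))
      ( walk-∷ʳ refl q
      , subst Unique (sym (map-++ tl (arcList q) (e ∷ []))) (tails∷ʳend-unique q)
      , subst Unique (sym (map-++ hd (arcList q) (e ∷ []))) (Unique-∷⇒∷ʳ (start∷heads-unique q))) ,
    tl-head-∷ʳ refl q , cong hd (last-∷ʳ (arcList q) e)

  suffixFrom : ∀ {s u w} (q : SimplePath s w) → u ∈ visited q → SimplePath u w
  suffixFrom []               (here refl) = []
  suffixFrom (cons e e↤s q n) (here refl) = cons e e↤s q n
  suffixFrom (cons _ _ q _)   (there u∈q) = suffixFrom q u∈q

  prepend : ∀ {u w} e → tl e ≡ u → SimplePath (hd e) w → SimplePath u w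
  prepend {u} e e↤u q with u ∈? visited q
  ... | yes u∈q = suffixFrom q u∈q
  ... | no  u∉q = cons e e↤u q u∉q

  walk⇒simplePath : ∀ {u w} p → WalkFromTo G u w p → SimplePath u w
  walk⇒simplePath []       refl                = []
  walk⇒simplePath (e ∷ es) (walk , e↤u , last↦w) =
    prepend e e↤u (walk⇒simplePath es (rest es walk last↦w))
    where
    rest : ∀ {w} es → IsWalk G (e ∷ es) → hd (last (e ∷ es)) ≡ w → WalkFromTo G (hd e) w es
    rest []        _             last↦w = last↦w
    rest (e′ ∷ es) (e↦e′ ∷ walk) last↦w =
      walk , sym e↦e′ , trans (cong hd (sym (last-∷-∷ e e′ es))) last↦w

  omnitig₂⇒walk : ∀ {f g} → IsOmnitig G (f ∷ g ∷ []) → hd f ≡ tl g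
  omnitig₂⇒walk (_ , f↦g ∷ _ , _) = f↦g

  omnitig₂-forces-last : ∀ {v f g c} → IsOmnitig G (f ∷ g ∷ []) → hd f ≡ v →
                         NEPathFromTo G v v c → L⁺.head c ≢ g → last c ≡ f
  omnitig₂-forces-last {f = f} {c = c} ω@(_ , _ , no-bypass) refl c-closed c≢g with last c Fin.≟ f
  ... | yes c↦f = c↦f
  ... | no  c↛f = ⊥-elim (no-bypass zero (suc zero) (s≤s z≤n)
        (c , subst (λ x → NEPathFromTo G x (hd f) c) (omnitig₂⇒walk ω) c-closed , c≢g , c↛f))

  module _ (strong : StronglyConnected G) where

    simplePath : ∀ u w → SimplePath u w
    simplePath u w = walk⇒simplePath (proj₁ (strong u w)) (proj₂ (strong u w))

    closedPath-leaving-by : ∀ {v} e → tl e ≡ v → ∃ λ c → NEPathFromTo G v v c × L⁺.head c ≡ e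
    closedPath-leaving-by e refl = _ , ∷-closedPath e (simplePath (hd e) (tl e)) , refl

    closedPath-entering-by : ∀ {v} e → hd e ≡ v → ∃ λ c → NEPathFromTo G v v c × last c ≡ e
    closedPath-entering-by e refl = _ , ∷ʳ-closedPath e q , last-∷ʳ (arcList q) e
      where q = simplePath (hd e) (tl e)

    module _ {v f g f′ g′} (ω : IsOmnitig G (f ∷ g ∷ [])) (ω′ : IsOmnitig G (f′ ∷ g′ ∷ []))
             (f↦v : hd f ≡ v) (f′↦v : hd f′ ≡ v) where

      same-last-arc : ∀ {x} → tl x ≡ v → x ≢ g → x ≢ g′ → f ≡ f′
      same-last-arc {x} x↤v x≢g x≢g′ with closedPath-leaving-by x x↤v
      ... | c , c-closed , refl =
        trans (sym (omnitig₂-forces-last ω f↦v c-closed x≢g))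
              (omnitig₂-forces-last ω′ f′↦v c-closed x≢g′)

      out-arc-cases : f ≢ f′ → ∀ x → tl x ≡ v → x ≡ g ⊎ x ≡ g′
      out-arc-cases f≢f′ x x↤v with x Fin.≟ g | x Fin.≟ g′
      ... | yes x≡g | _        = inj₁ x≡g
      ... | no  _   | yes x≡g′ = inj₂ x≡g′
      ... | no  x≢g | no  x≢g′ = ⊥-elim (f≢f′ (same-last-arc x↤v x≢g x≢g′))

      in-arc-cases : g ≢ g′ → ∀ x → hd x ≡ v → x ≡ f ⊎ x ≡ f′
      in-arc-cases g≢g′ x x↦v with closedPath-entering-by x x↦v
      ... | c , c-closed , refl with L⁺.head c Fin.≟ g
      ...   | yes c≡g = inj₂ (omnitig₂-forces-last ω′ f′↦v c-closed
                                 (λ c≡g′ → g≢g′ (trans (sym c≡g) c≡g′)))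
      ...   | no  c≢g = inj₁ (omnitig₂-forces-last ω f↦v c-closed c≢g)

open Graph

-- ¬ IsClosedPath G and the join/split hypotheses on the four arcs are unused: all of them
-- follow from bivalence of v, which alone supplies the lower bounds on the degrees.
theorem5 : (G : Graph) → StronglyConnected G → ¬ IsClosedPath G →
    (v : Node G) → Bivalent G v →
    (f₁ f₂ g₁ g₂ : Arc G) →
    f₁ ≢ f₂ → JoinArc G f₁ → JoinArc G f₂ → hd G f₁ ≡ v → hd G f₂ ≡ v →
    g₁ ≢ g₂ → SplitArc G g₁ → SplitArc G g₂ → tl G g₁ ≡ v → tl G g₂ ≡ v →
    ((IsOmnitig G (f₁ ∷ g₁ ∷ []) → IsOmnitig G (f₂ ∷ g₂ ∷ []) →
        outdeg G v ≡ 2 × indeg G v ≡ 2)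
    × (IsOmnitig G (f₁ ∷ g₁ ∷ []) →
        (∀ (g′ : Arc G) → g′ ≢ g₁ → ¬ IsOmnitig G (f₁ ∷ g′ ∷ []))
      × (∀ (f′ : Arc G) → f′ ≢ f₁ → ¬ IsOmnitig G (f′ ∷ g₁ ∷ []))))
theorem5 G strong _ v (v-join , v-split) f₁ f₂ g₁ g₂ f₁≢f₂ _ _ f₁↦v f₂↦v g₁≢g₂ _ _ g₁↤v g₂↤v =
    (λ ω₁ ω₂ →
        ≤-antisym (outdeg≤2 G (out-arc-cases G strong ω₁ ω₂ f₁↦v f₂↦v f₁≢f₂)) v-split
      , ≤-antisym (indeg≤2 G (in-arc-cases G strong ω₁ ω₂ f₁↦v f₂↦v g₁≢g₂)) v-join)
  , λ ω₁ →
      (λ g′ g′≢g₁ ω′ → f₁≢f₂ (sym (reduce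
          (in-arc-cases G strong ω₁ ω′ f₁↦v f₁↦v (≢-sym g′≢g₁) f₂ f₂↦v))))
    , (λ f′ f′≢f₁ ω′ → f′≢f₁ (sym
          (same-last-arc G strong ω₁ ω′ f₁↦v (trans (omnitig₂⇒walk G ω′) g₁↤v)
             g₂↤v (≢-sym g₁≢g₂) (≢-sym g₁≢g₂))))
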